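{- Let $\Sigma$ be an action signature. As a frame, the canonical action model $\Omega$ is locally finite: for each simple action $\alpha$ there are only finitely many simple actions $\beta$ such that $\alpha\to^*\beta$, where $\to^*$ is the reflexive-transitive closure of $\bigcup_{A\in\mathrm{Agents}}\to_A$.
   Context: Fix AtSen and Agents. An action signature $\Sigma$ is a finite set with binary relations $\to_A$ ($A\in$ Agents) and an enumeration $\sigma_1,\dots,\sigma_n$. In the language $\mathcal L(\Sigma)$, programs are built by $\mathsf{skip}\mid\mathsf{crash}\mid\sigma_i\psi_1\cdots\psi_n\mid\pi\cup\rho\mid\pi;\rho\mid\pi^*$ (with $\psi_j$ sentences of $\mathcal L(\Sigma)$); simple actions are programs containing neither $\cup$ nor $*$. $\Omega$ has as elements the simple actions, with $\to_A$ the smallest relations such that $\mathsf{skip}\to_A\mathsf{skip}$; $\sigma_i\vec\varphi\to_A\sigma_j\vec\psi$ iff $\sigma_i\to_A\sigma_j$ in $\Sigma$ and $\vec\varphi=\vec\psi$; and $\alpha;\beta\to_A\alpha';\beta'$ whenever $\alpha\to_A\alpha'$ and $\beta\to_A\beta'$. -}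

module Defs where

open import Data.Nat using (ℕ)
open import Data.Fin using (Fin)
open import Data.Vec using (Vec)
open import Data.List using (List)
open import Data.List.Membership.Propositional using (_∈_)
open import Data.Product using (Σ; ∃; _×_)
open import Relation.Binary.PropositionalEquality using (_≡_)
open import Relation.Binary.Construct.Closure.ReflexiveTransitive using (Star)

record ActionSignature (Agents : Set) : Set₁ where
  field
    size : ℕ
    arrow : Agents → Fin size → Fin size → Set

module Language (AtSen Agents : Set) (S : ActionSignature Agents) where
  open ActionSignature S renaming (size to n)

  -- Sentences and programs of L(Σ) (mutually inductive).
  -- Sentences: true, atomic p, ¬φ, φ∧ψ, [π]φ, □_A φ, □*_B φ (B a list of agents).
  data Sentence : Set
  data Program : Set

  data Sentence where
    true  : Sentence
    atom  : AtSen → Sentence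
    neg   : Sentence → Sentence
    and   : Sentence → Sentence → Sentence
    box   : Program → Sentence → Sentence
    kbox  : Agents → Sentence → Sentence
    cbox  : List Agents → Sentence → Sentence

  data Program where
    skip  : Program
    crash : Program
    act   : Fin n → Vec Sentence n → Program
    _∪_   : Program → Program → Program
    _⨾_   : Program → Program → Program
    _*    : Program → Program

  data Simple : Program → Set where
    skip  : Simple skip
    crash : Simple crash
    act   : ∀ i ψs → Simple (act i ψs)
    seq   : ∀ {α β} → Simple α → Simple β → Simple (α ⨾ β)

  data Step (A : Agents) : Program → Program → Set where
    skip : Step A skip skip
    act  : ∀ {i j φs ψs} → arrow A i j → φs ≡ ψs → Step A (act i φs) (act j ψs)
    seq  : ∀ {α α' β β'} → Step A α α' → Step A β β' → Step A (α ⨾ β) (α' ⨾ β')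

  -- Elements of Ω are the simple actions; arrows are restricted to them.
  ΩArrow : Agents → Program → Program → Set
  ΩArrow A α β = Simple α × Simple β × Step A α β

  AnyArrow : Program → Program → Set
  AnyArrow α β = ∃ λ A → ΩArrow A α β

  _→*_ : Program → Program → Set
  _→*_ = Star AnyArrow

  LocallyFinite : Set
  LocallyFinite = (α : Program) → Simple α →
    Σ (List Program) λ L → (β : Program) → Simple β → α →* β → β ∈ L

-- An arrow of Ω only replaces action labels σᵢ by other labels σⱼ: it keeps the
-- ;-structure and every precondition vector. So everything reachable from a simple
-- action α is a relabelling of α, and there are at most n^k of those when α has k
-- occurrences of action labels.
module Submission where

open import Defs
open import Data.List using (List; []; _∷_; map; allFin; cartesianProductWith)
open import Data.List.Membership.Propositional using (_∈_)
open import Data.List.Membership.Propositional.Properties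
  using (∈-map⁺; ∈-allFin; ∈-cartesianProductWith⁺)
open import Data.List.Relation.Unary.Any using (here)
open import Data.Product using (_,_)
open import Relation.Binary.PropositionalEquality using (refl)
open import Relation.Binary.Construct.Closure.ReflexiveTransitive using (ε; _◅_)

module LocalFiniteness (AtSen Agents : Set) (S : ActionSignature Agents) where
  open ActionSignature S renaming (size to n)
  open Language AtSen Agents S

  data Relabelling : Program → Program → Set where
    skip  : Relabelling skip skip
    crash : Relabelling crash crash
    act   : ∀ i j ψs → Relabelling (act i ψs) (act j ψs)
    seq   : ∀ {α α′ β β′} → Relabelling α α′ → Relabelling β β′ →
            Relabelling (α ⨾ β) (α′ ⨾ β′)

  relabelling-refl : ∀ {α} → Simple α → Relabelling α α
  relabelling-refl skip       = skip
  relabelling-refl crash      = crash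
  relabelling-refl (act i ψs) = act i i ψs
  relabelling-refl (seq s t)  = seq (relabelling-refl s) (relabelling-refl t)

  relabelling-step : ∀ {A α β γ} → Relabelling α β → Step A β γ → Relabelling α γ
  relabelling-step skip         skip         = skip
  relabelling-step (act i _ ψs) (act _ refl) = act i _ ψs
  relabelling-step (seq r₁ r₂)  (seq s₁ s₂)  =
    seq (relabelling-step r₁ s₁) (relabelling-step r₂ s₂)

  relabelling-→* : ∀ {α β γ} → Relabelling α β → β →* γ → Relabelling α γ
  relabelling-→* r ε                      = r
  relabelling-→* r ((_ , _ , _ , s) ◅ ss) = relabelling-→* (relabelling-step r s) ss

  -- Junk value [] on programs containing ∪ or *, which have no relabellings.
  relabellings : Program → List Program
  relabellings skip       = skip ∷ []
  relabellings crash      = crash ∷ []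
  relabellings (act _ ψs) = map (λ j → act j ψs) (allFin n)
  relabellings (α ⨾ β)    = cartesianProductWith _⨾_ (relabellings α) (relabellings β)
  relabellings (_ ∪ _)    = []
  relabellings (_ *)      = []

  ∈-relabellings : ∀ {α β} → Relabelling α β → β ∈ relabellings α
  ∈-relabellings skip         = here refl
  ∈-relabellings crash        = here refl
  ∈-relabellings (act _ j ψs) = ∈-map⁺ (λ k → act k ψs) (∈-allFin j)
  ∈-relabellings (seq r₁ r₂)  =
    ∈-cartesianProductWith⁺ _⨾_ (∈-relabellings r₁) (∈-relabellings r₂)

  locallyFinite : LocallyFinite
  locallyFinite α simple =
    relabellings α , λ _ _ α→*β → ∈-relabellings (relabelling-→* (relabelling-refl simple) α→*β)

mainTheorem16 : (AtSen Agents : Set) (S : ActionSignature Agents) → Language.LocallyFinite AtSen Agents S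
mainTheorem16 = LocalFiniteness.locallyFinite
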